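{- There exists an absolute constant $C>0$ such that for every finite connected graph $G$, $c(G) \leq \gamma(G)-\frac{D(G)}{3} + C\sqrt{D(G)}$, where $c(G)$ is the cop number, $\gamma(G)$ the domination number and $D(G)$ the diameter of $G$. (That is, $c(G) \leq \gamma(G) - \frac{D(G)}{3} + O(\sqrt{D(G)})$.)
   Context: The game of Cops and Robbers on a finite undirected graph $G$: one player controls $k$ cops and the other a single robber. First the cops choose starting vertices (several cops may share a vertex), then the robber chooses a starting vertex. Players then alternate turns, beginning with the cops; on the cops' turn each cop moves to a vertex at distance at most $1$ from its current vertex, and on the robber's turn the robber does likewise. The cops win if at some point the robber occupies the same vertex as some cop; otherwise the robber wins. The cop number $c(G)$ is the minimum $k$ such that $k$ cops have a winning strategy. The domination number $\gamma(G)$ is the minimum size of a set $S \subseteq V(G)$ such that every vertex not in $S$ has a neighbour in $S$. $D(G)$ is the maximum distance between two vertices of $G$. -}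

module Defs where

open import Data.Nat using (ℕ; zero; suc; _≤_)
open import Data.Fin using (Fin)
open import Data.Fin.Subset using (Subset; _∈_)
open import Data.Product using (Σ; ∃; _×_; _,_)
open import Data.Sum using (_⊎_)
open import Relation.Binary.PropositionalEquality using (_≡_)
open import Relation.Nullary using (¬_)

record Graph : Set₁ where
  field
    n       : ℕ
    Adj     : Fin n → Fin n → Set
    sym     : ∀ {u v} → Adj u v → Adj v u
    irrefl  : ∀ {u} → ¬ Adj u u

module _ (G : Graph) where
  open Graph G

  Step : Fin n → Fin n → Set
  Step u v = u ≡ v ⊎ Adj u v

  data Walk : Fin n → Fin n → ℕ → Set where
    nil  : ∀ {v} → Walk v v 0
    cons : ∀ {u w v l} → Adj u w → Walk w v l → Walk u v (suc l)

  Connected : Set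
  Connected = ∀ u v → ∃ λ l → Walk u v l

  -- D is the diameter: maximum over pairs of the distance
  -- (distance = least length of a walk)
  IsDiameter : ℕ → Set
  IsDiameter D =
    (∀ u v → ∃ λ l → l ≤ D × Walk u v l) ×
    (Σ (Fin n) λ u → Σ (Fin n) λ v → ∀ l → Walk u v l → D ≤ l)

  Dominating : Subset n → Set
  Dominating S = ∀ v → v ∈ S ⊎ (Σ (Fin n) λ u → u ∈ S × Adj u v)

  module _ (k : ℕ) where
    Caught : (Fin k → Fin n) → Fin n → Set
    Caught cops r = Σ (Fin k) λ i → cops i ≡ r

    -- CopsWinFrom cops r : it is the cops' turn, cops at 'cops', robber at r,
    -- and the cops can force a capture in finitely many moves.
    data CopsWinFrom (cops : Fin k → Fin n) (r : Fin n) : Set where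
      caught : Caught cops r → CopsWinFrom cops r
      move   : (cops′ : Fin k → Fin n) →
               (∀ i → Step (cops i) (cops′ i)) →
               (Caught cops′ r ⊎ (∀ r′ → Step r r′ → CopsWinFrom cops′ r′)) →
               CopsWinFrom cops r

    CopsWin : Set
    CopsWin = Σ (Fin k → Fin n) λ start → ∀ r → CopsWinFrom start r

-- Take a diametral geodesic p₀ … p_D and a dominating set S.  For j ≤ M = ⌊D/3⌋ let the
-- anchor a_j be a vertex of S dominating p_{3j}; since p is a geodesic the anchors are
-- distinct, and a robber step can lower the index of the anchor dominating the robber by
-- at most one.  Put one cop on every vertex of S that is not an anchor, so the robber must
-- always stand next to some anchor, and use two further cops to sweep the anchors: one
-- guards a_b, so the robber's anchor index stays above b, while the other walks in 8 steps
-- to a_{b+1}; then the roles swap.  The robber is pushed past a_M and caught, using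
-- at most 2 + |S| − (M + 1) cops, i.e. c(G) ≤ γ(G) − D/3 + O(1).
module Submission where

open import Defs
open import Data.Nat using (ℕ; _+_; _*_; _∸_; _^_; _≤_)
open import Data.Fin.Subset using (Subset; ∣_∣)
open import Data.Product using (Σ; ∃; _×_)

open import Data.Nat as ℕ using (zero; suc; _<_; s≤s; z≤n)
open import Data.Nat.Properties
open import Data.Nat.DivMod using (_/_; _%_; m≡m%n+[m/n]*n; m%n<n; m/n*n≤m; m≥n⇒m/n>0)
open import Data.Nat.Tactic.RingSolver using (solve-∀)
open import Data.Fin as F using (Fin) renaming (zero to fz; suc to fs)
open import Data.Fin.Subset using (_∈_; _-_; inside; outside)
open import Data.Fin.Subset.Properties using (x∈p∧x≢y⇒x∈p-y; x∈p⇒∣p-x∣<∣p∣)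
open import Data.Vec.Base using ([]; _∷_; here; there)
open import Data.Vec.Functional using (updateAt)
open import Data.Vec.Functional.Properties using (updateAt-updates; updateAt-minimal)
open import Data.Product using (_,_; ∃₂)
open import Data.Sum using (_⊎_; inj₁; inj₂)
open import Data.Empty using (⊥-elim)
open import Function using (_∘_; const)
open import Relation.Nullary using (yes; no)
open import Relation.Binary.PropositionalEquality

3*m≤3*n+2⇒m≤n : ∀ m n → 3 * m ≤ 3 * n + 2 → m ≤ n
3*m≤3*n+2⇒m≤n m n h = ≤-pred (*-cancelˡ-< 3 m (suc n) (≤-<-trans h 3*n+2<3*[1+n]))
  where
  3*n+2<3*[1+n] : 3 * n + 2 < 3 * suc n
  3*n+2<3*[1+n] rewrite *-suc 3 n | +-comm (3 * n) 2 = ≤-refl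

square-≤ : ∀ {x a b} → x ≤ a → x ≤ b → x ^ 2 ≤ a * b
square-≤ {x} x≤a x≤b = *-mono-≤ x≤a (subst (_≤ _) (sym (*-identityʳ x)) x≤b)

3*[m/3]≤m : ∀ m → 3 * (m / 3) ≤ m
3*[m/3]≤m m = subst (_≤ m) (*-comm (m / 3) 3) (m/n*n≤m m 3)

m≤3*[m/3]+2 : ∀ m → m ≤ 3 * (m / 3) + 2
m≤3*[m/3]+2 m = begin
  m                   ≡⟨ m≡m%n+[m/n]*n m 3 ⟩
  m % 3 + m / 3 * 3   ≤⟨ +-monoˡ-≤ (m / 3 * 3) (≤-pred (m%n<n m 3)) ⟩
  2 + m / 3 * 3       ≡⟨ +-comm 2 (m / 3 * 3) ⟩
  m / 3 * 3 + 2       ≡⟨ cong (_+ 2) (*-comm (m / 3) 3) ⟩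
  3 * (m / 3) + 2     ∎
  where open ≤-Reasoning

elements : ∀ {n} (p : Subset n) → Fin ∣ p ∣ → Fin n
elements (inside ∷ p) fz = fz
elements (inside ∷ p) (fs i) = fs (elements p i)
elements (outside ∷ p) i = fs (elements p i)

elements-onto : ∀ {n} (p : Subset n) {x} → x ∈ p → ∃ λ i → elements p i ≡ x
elements-onto (inside ∷ p) here = fz , refl
elements-onto (inside ∷ p) (there x∈p) with elements-onto p x∈p
... | i , eq = fs i , cong fs eq
elements-onto (outside ∷ p) (there x∈p) with elements-onto p x∈p
... | i , eq = i , cong fs eq

module Play (G : Graph) where
  open Graph G using (n)

  Step-sym : ∀ {x y} → Step G x y → Step G y x
  Step-sym (inj₁ refl) = inj₁ refl
  Step-sym (inj₂ a) = inj₂ (Graph.sym G a)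

  data StepWalk : Fin n → Fin n → ℕ → Set where
    [] : ∀ {x} → StepWalk x x 0
    _∷_ : ∀ {x y z l} → Step G x y → StepWalk y z l → StepWalk x z (suc l)

  _++_ : ∀ {x y z l m} → StepWalk x y l → StepWalk y z m → StepWalk x z (l + m)
  [] ++ q = q
  (s ∷ p) ++ q = s ∷ (p ++ q)

  StepWalk⇒Walk : ∀ {x y l} → StepWalk x y l → ∃ λ l′ → l′ ≤ l × Walk G x y l′
  StepWalk⇒Walk [] = 0 , z≤n , nil
  StepWalk⇒Walk (inj₁ refl ∷ p) with StepWalk⇒Walk p
  ... | l′ , l′≤l , w = l′ , m≤n⇒m≤1+n l′≤l , w
  StepWalk⇒Walk (inj₂ a ∷ p) with StepWalk⇒Walk p
  ... | l′ , l′≤l , w = suc l′ , s≤s l′≤l , cons a w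

  -- Past the end of the walk, vertex returns its last vertex.
  vertex : ∀ {a b l} → Walk G a b l → ℕ → Fin n
  vertex {a} _ zero = a
  vertex {b = b} nil (suc i) = b
  vertex (cons _ w) (suc i) = vertex w i

  vertex-last : ∀ {a b l} (w : Walk G a b l) → vertex w l ≡ b
  vertex-last nil = refl
  vertex-last (cons _ w) = vertex-last w

  segment : ∀ {a b l} (w : Walk G a b l) i d → i + d ≤ l → StepWalk (vertex w i) (vertex w (i + d)) d
  segment nil zero zero _ = []
  segment (cons e w) zero zero _ = []
  segment (cons e w) zero (suc d) (s≤s le) = inj₂ e ∷ segment w zero d le
  segment (cons e w) (suc i) d (s≤s le) = segment w i d le

  segment-from : ∀ {a b l} (w : Walk G a b l) i → i ≤ l → StepWalk (vertex w i) b (l ∸ i)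
  segment-from {l = l} w i i≤l =
    subst (λ z → StepWalk (vertex w i) z (l ∸ i)) (trans (cong (vertex w) i+[l∸i]≡l) (vertex-last w))
          (segment w i (l ∸ i) (≤-reflexive i+[l∸i]≡l))
    where
    i+[l∸i]≡l : i + (l ∸ i) ≡ l
    i+[l∸i]≡l = m+[n∸m]≡n i≤l

  diametral-walk : ∀ {D} → IsDiameter G D →
                   ∃₂ λ u v → Walk G u v D × (∀ l → Walk G u v l → D ≤ l)
  diametral-walk (bounded , u , v , shortest) with bounded u v
  ... | l , l≤D , w = u , v , subst (Walk G u v) (≤-antisym l≤D (shortest l w)) w , shortest

  module _ {u v D} (w : Walk G u v D) (shortest : ∀ l → Walk G u v l → D ≤ l) where

    StepWalk-length-≥ : ∀ {m} → StepWalk u v m → D ≤ m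
    StepWalk-length-≥ p with StepWalk⇒Walk p
    ... | l , l≤m , w′ = ≤-trans (shortest l w′) l≤m

    geodesic-≤ : ∀ {i i′ ℓ} → i ≤ D → i′ ≤ D → StepWalk (vertex w i) (vertex w i′) ℓ → i′ ≤ i + ℓ
    geodesic-≤ {i} {i′} {ℓ} i≤D i′≤D p = +-cancelʳ-≤ (D ∸ i′) i′ (i + ℓ) (begin
      i′ + (D ∸ i′)      ≡⟨ m+[n∸m]≡n i′≤D ⟩
      D                  ≤⟨ StepWalk-length-≥ (segment w 0 i i≤D ++ (p ++ segment-from w i′ i′≤D)) ⟩
      i + (ℓ + (D ∸ i′)) ≡⟨ +-assoc i ℓ (D ∸ i′) ⟨
      i + ℓ + (D ∸ i′)   ∎)
      where open ≤-Reasoning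

  capture : ∀ {k} {cops : Fin k → Fin n} {r x} i → cops i ≡ x → Step G x r → CopsWinFrom G k cops r
  capture {cops = cops} {r} i cops-i≡x x→r =
    move (updateAt cops i (const r)) steps (inj₁ (i , updateAt-updates i cops))
    where
    steps : ∀ j → Step G (cops j) (updateAt cops i (const r) j)
    steps j with j F.≟ i
    ... | yes refl = subst (Step G (cops i)) (sym (updateAt-updates i cops))
                           (subst (λ z → Step G z r) (sym cops-i≡x) x→r)
    ... | no j≢i = inj₁ (sym (updateAt-minimal j i cops j≢i))

  -- Cops are interchangeable: a team in which cop i shadows cop σ i of another team wins
  -- whenever that team does, provided every cop of it is shadowed.
  CopsWinFrom-reindex : ∀ {k k′} {cops : Fin k → Fin n} {cops′ : Fin k′ → Fin n} {r} (σ : Fin k → Fin k′) →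
                        (∀ i′ → ∃ λ i → σ i ≡ i′) → (∀ i → cops i ≡ cops′ (σ i)) →
                        CopsWinFrom G k′ cops′ r → CopsWinFrom G k cops r
  CopsWinFrom-reindex {k} {k′} σ onto = reindex
    where
    Caught-reindex : ∀ {c : Fin k → Fin n} {c′ r} → (∀ i → c i ≡ c′ (σ i)) → Caught G k′ c′ r → Caught G k c r
    Caught-reindex shadow (i′ , c′i′≡r) with onto i′
    ... | i , refl = i , trans (shadow i) c′i′≡r

    reindex : ∀ {c : Fin k → Fin n} {c′ r} → (∀ i → c i ≡ c′ (σ i)) → CopsWinFrom G k′ c′ r → CopsWinFrom G k c r
    reindex shadow (caught c) = caught (Caught-reindex shadow c)
    reindex shadow (move c″ steps next) =
      move (c″ ∘ σ) (λ i → subst (λ z → Step G z (c″ (σ i))) (sym (shadow i)) (steps (σ i))) (continue next)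
      where
      continue : ∀ {r} → Caught G k′ c″ r ⊎ (∀ r′ → Step G r r′ → CopsWinFrom G k′ c″ r′) →
                 Caught G k (c″ ∘ σ) r ⊎ (∀ r′ → Step G r r′ → CopsWinFrom G k (c″ ∘ σ) r′)
      continue (inj₁ c) = inj₁ (Caught-reindex (λ _ → refl) c)
      continue (inj₂ win) = inj₂ λ r′ r→r′ → reindex (λ _ → refl) (win r′ r→r′)

module Domination {G : Graph} {S : Subset (Graph.n G)} (dom : Dominating G S) where
  open Graph G using (n)
  open Play G

  dominator : Fin n → Fin n
  dominator v with dom v
  ... | inj₁ _ = v
  ... | inj₂ (s , _ , _) = s

  dominator∈S : ∀ v → dominator v ∈ S
  dominator∈S v with dom v
  ... | inj₁ v∈S = v∈S
  ... | inj₂ (_ , s∈S , _) = s∈S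

  dominator-step : ∀ v → Step G (dominator v) v
  dominator-step v with dom v
  ... | inj₁ _ = inj₁ refl
  ... | inj₂ (_ , _ , s~v) = inj₂ s~v

  ≡dominator⇒step : ∀ {x v} → x ≡ dominator v → Step G x v
  ≡dominator⇒step {v = v} refl = dominator-step v

  dominating⇒CopsWin : CopsWin G ∣ S ∣
  dominating⇒CopsWin = elements S , λ r →
    let i , eq = elements-onto S (dominator∈S r) in capture i eq (dominator-step r)

module Chase {G : Graph} {S : Subset (Graph.n G)} (dom : Dominating G S)
             {u v D} (w : Walk G u v D) (shortest : ∀ l → Walk G u v l → D ≤ l)
             (M : ℕ) (3M≤D : 3 * M ≤ D) where
  open Graph G using (n)
  open Play G
  open Domination {G} {S} dom

  spine : ℕ → Fin n
  spine j = vertex w (3 * j)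

  anchor : ℕ → Fin n
  anchor j = dominator (spine j)

  spine-gap : ∀ {j j′ ℓ} → j ≤ M → j′ ≤ M → StepWalk (spine j′) (spine j) ℓ → 3 * j ≤ 3 * j′ + ℓ
  spine-gap j≤M j′≤M = geodesic-≤ w shortest (on-spine j′≤M) (on-spine j≤M)
    where
    on-spine : ∀ {j} → j ≤ M → 3 * j ≤ D
    on-spine j≤M = ≤-trans (*-monoʳ-≤ 3 j≤M) 3M≤D

  anchor-injective : ∀ {j j′} → j ≤ M → j′ ≤ M → anchor j ≡ anchor j′ → j ≡ j′
  anchor-injective {j} {j′} j≤M j′≤M eq =
    ≤-antisym (3*m≤3*n+2⇒m≤n j j′ (spine-gap j≤M j′≤M (via-anchor {j} {j′} eq)))
              (3*m≤3*n+2⇒m≤n j′ j (spine-gap j′≤M j≤M (via-anchor {j′} {j} (sym eq))))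
    where
    via-anchor : ∀ {i i′} → anchor i ≡ anchor i′ → StepWalk (spine i′) (spine i) 2
    via-anchor {i} {i′} eq =
      Step-sym (dominator-step (spine i′)) ∷ (subst (λ z → Step G z (spine i)) eq (dominator-step (spine i)) ∷ [])

  anchor-drift : ∀ {j j′ x y} → j ≤ M → j′ ≤ M → anchor j ≡ dominator x → anchor j′ ≡ dominator y →
                 Step G x y → j ≤ suc j′
  anchor-drift {j} {j′} {x} {y} j≤M j′≤M ax ay x→y =
    3*m≤3*n+2⇒m≤n j (suc j′) (subst (3 * j ≤_) (3m+5≡3[1+m]+2 j′) (spine-gap j≤M j′≤M detour))
    where
    3m+5≡3[1+m]+2 : ∀ m → 3 * m + 5 ≡ 3 * suc m + 2
    3m+5≡3[1+m]+2 = solve-∀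
    detour : StepWalk (spine j′) (spine j) 5
    detour = Step-sym (dominator-step (spine j′)) ∷ (≡dominator⇒step ay ∷ (Step-sym x→y ∷
             (Step-sym (≡dominator⇒step ax) ∷ (dominator-step (spine j) ∷ []))))

  anchor-leap : ∀ a → 2 + a ≤ M → StepWalk (anchor a) (anchor (2 + a)) 8
  anchor-leap a 2+a≤M = dominator-step (spine a) ∷ (along ++ (Step-sym (dominator-step (spine (2 + a))) ∷ []))
    where
    3m+6≡3[2+m] : ∀ m → 3 * m + 6 ≡ 3 * (2 + m)
    3m+6≡3[2+m] = solve-∀
    along : StepWalk (spine a) (spine (2 + a)) 6
    along = subst (λ i → StepWalk (spine a) (vertex w i) 6) (3m+6≡3[2+m] a)
              (segment w (3 * a) 6 (subst (_≤ D) (sym (3m+6≡3[2+m] a)) (≤-trans (*-monoʳ-≤ 3 2+a≤M) 3M≤D)))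

  Unclaimed : ℕ → Subset n
  Unclaimed zero = S
  Unclaimed (suc m) = Unclaimed m - anchor m

  ∈-Unclaimed : ∀ m {x} → x ∈ S → (∀ j → j < m → anchor j ≢ x) → x ∈ Unclaimed m
  ∈-Unclaimed zero x∈S _ = x∈S
  ∈-Unclaimed (suc m) x∈S unanchored =
    x∈p∧x≢y⇒x∈p-y (∈-Unclaimed m x∈S (λ j j<m → unanchored j (m<n⇒m<1+n j<m)))
                  (unanchored m ≤-refl ∘ sym)

  ∣Unclaimed∣ : ∀ m → m ≤ suc M → ∣ Unclaimed m ∣ + m ≤ ∣ S ∣
  ∣Unclaimed∣ zero _ = ≤-reflexive (+-identityʳ ∣ S ∣)
  ∣Unclaimed∣ (suc m) m<1+M = begin
    ∣ Unclaimed (suc m) ∣ + suc m   ≡⟨ +-suc _ m ⟩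
    suc ∣ Unclaimed (suc m) ∣ + m   ≤⟨ +-monoˡ-≤ m (x∈p⇒∣p-x∣<∣p∣ anchor-m-unclaimed) ⟩
    ∣ Unclaimed m ∣ + m             ≤⟨ ∣Unclaimed∣ m (m≤n⇒m≤1+n m≤M) ⟩
    ∣ S ∣                           ∎
    where
    open ≤-Reasoning
    m≤M : m ≤ M
    m≤M = ≤-pred m<1+M
    anchor-m-unclaimed : anchor m ∈ Unclaimed m
    anchor-m-unclaimed = ∈-Unclaimed m (dominator∈S (spine m)) λ j j<m aj≡am →
      <-irrefl (anchor-injective (≤-trans (<⇒≤ j<m) m≤M) m≤M aj≡am) j<m

  Free : Subset n
  Free = Unclaimed (suc M)

  K : ℕ
  K = ∣ Free ∣

  -- Cop 0 guards an anchor, cop 1 travels to the next one, the others sit on Free.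
  formation : Fin n → Fin n → Fin (2 + K) → Fin n
  formation g t fz = g
  formation g t (fs fz) = t
  formation g t (fs (fs i)) = elements Free i

  formation-step : ∀ {g t t′} → Step G t t′ → ∀ i → Step G (formation g t i) (formation g t′ i)
  formation-step t→t′ fz = inj₁ refl
  formation-step t→t′ (fs fz) = t→t′
  formation-step t→t′ (fs (fs i)) = inj₁ refl

  formation-swap : ∀ {g t r} → CopsWinFrom G (2 + K) (formation t g) r → CopsWinFrom G (2 + K) (formation g t) r
  formation-swap = CopsWinFrom-reindex swap (λ i → swap i , swap-involutive i) shadow
    where
    swap : Fin (2 + K) → Fin (2 + K)
    swap fz = fs fz
    swap (fs fz) = fz
    swap (fs (fs i)) = fs (fs i)
    swap-involutive : ∀ i → swap (swap i) ≡ i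
    swap-involutive fz = refl
    swap-involutive (fs fz) = refl
    swap-involutive (fs (fs i)) = refl
    shadow : ∀ {g t} i → formation g t i ≡ formation t g (swap i)
    shadow fz = refl
    shadow (fs fz) = refl
    shadow (fs (fs i)) = refl

  AnchoredAbove : ℕ → Fin n → Set
  AnchoredAbove b r = ∀ j → j ≤ M → anchor j ≡ dominator r → b ≤ j

  locate : ∀ {b t} r → AnchoredAbove b r →
           CopsWinFrom G (2 + K) (formation (anchor b) t) r ⊎ (∃ λ j → j ≤ M × anchor j ≡ dominator r × b < j)
  locate {b} r above with anyUpTo? (λ j → anchor j F.≟ dominator r) (suc M)
  ... | no unanchored =
    let i , eq = elements-onto Free (∈-Unclaimed (suc M) (dominator∈S r)
                                       λ j j<1+M aj≡dr → unanchored (j , j<1+M , aj≡dr))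
    in inj₁ (capture (fs (fs i)) eq (dominator-step r))
  ... | yes (j , j<1+M , aj≡dr) with j ℕ.≟ b
  ...   | yes refl = inj₁ (capture fz refl (≡dominator⇒step aj≡dr))
  ...   | no j≢b = inj₂ (j , ≤-pred j<1+M , aj≡dr , ≤∧≢⇒< (above j (≤-pred j<1+M) aj≡dr) (j≢b ∘ sym))

  -- d counts the anchors beyond the traveller's target a_{b+1}.
  mutual
    chase : ∀ d b → d + suc b ≡ M → ∀ {t ℓ} → StepWalk t (anchor (suc b)) ℓ →
            ∀ r → AnchoredAbove b r → CopsWinFrom G (2 + K) (formation (anchor b) t) r
    chase d b d+1+b≡M [] r above with locate r above
    ... | inj₁ win = win
    ... | inj₂ (j , j≤M , aj≡dr , b<j) with j ℕ.≟ suc b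
    ...   | yes refl = capture (fs fz) refl (≡dominator⇒step aj≡dr)
    ...   | no j≢1+b = relay d b d+1+b≡M j≤M aj≡dr (≤∧≢⇒< b<j (j≢1+b ∘ sym))
    chase d b d+1+b≡M (t→t′ ∷ walk) r above with locate r above
    ... | inj₁ win = win
    ... | inj₂ (j , j≤M , aj≡dr , b<j) =
      move _ (formation-step t→t′) (inj₂ λ r′ r→r′ → chase d b d+1+b≡M walk r′ λ j′ j′≤M aj′≡dr′ →
        ≤-pred (≤-trans b<j (anchor-drift j≤M j′≤M aj≡dr aj′≡dr′ r→r′)))

    relay : ∀ d b → d + suc b ≡ M → ∀ {j r} → j ≤ M → anchor j ≡ dominator r → suc b < j →
            CopsWinFrom G (2 + K) (formation (anchor b) (anchor (suc b))) r
    relay zero b 1+b≡M j≤M _ 1+b<j = ⊥-elim (<⇒≱ 1+b<j (subst (_ ≤_) (sym 1+b≡M) j≤M))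
    relay (suc d) b d+2+b≡M {j} j≤M aj≡dr 1+b<j =
      formation-swap (chase d (suc b) d+1+[1+b]≡M (anchor-leap b 2+b≤M) _ λ j′ j′≤M aj′≡dr →
        ≤-trans (<⇒≤ 1+b<j) (≤-reflexive (anchor-injective j≤M j′≤M (trans aj≡dr (sym aj′≡dr)))))
      where
      d+1+[1+b]≡M : d + suc (suc b) ≡ M
      d+1+[1+b]≡M = trans (+-suc d (suc b)) d+2+b≡M
      2+b≤M : 2 + b ≤ M
      2+b≤M = ≤-trans 1+b<j j≤M

  chase-wins : 1 ≤ M → CopsWin G (2 + K)
  chase-wins 1≤M = formation (anchor 0) (anchor 1) , λ r → chase (M ∸ 1) 0 (m∸n+n≡m 1≤M) [] r λ _ _ _ → z≤n

  chase-excess : D ≤ 3 * M + 2 → (3 * (2 + K) + D) ∸ 3 * ∣ S ∣ ≤ 5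
  chase-excess D≤3M+2 = m≤n+o⇒m∸n≤o (3 * (2 + K) + D) (3 * ∣ S ∣) (begin
    3 * (2 + K) + D              ≤⟨ +-monoʳ-≤ (3 * (2 + K)) D≤3M+2 ⟩
    3 * (2 + K) + (3 * M + 2)    ≡⟨ regroup K M ⟩
    3 * (K + suc M) + 5          ≤⟨ +-monoˡ-≤ 5 (*-monoʳ-≤ 3 (∣Unclaimed∣ (suc M) ≤-refl)) ⟩
    3 * ∣ S ∣ + 5                ∎)
    where
    open ≤-Reasoning
    regroup : ∀ k m → 3 * (2 + k) + (3 * m + 2) ≡ 3 * (k + suc m) + 5
    regroup = solve-∀

few-cops : ∀ {G S} → Dominating G S → ∀ {u v D} (w : Walk G u v D) → (∀ l → Walk G u v l → D ≤ l) →
           ∃ λ k → CopsWin G k × ((3 * k + D) ∸ 3 * ∣ S ∣) ^ 2 ≤ 25 * D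
few-cops {G} {S} dom {D = D} w shortest with D ℕ.<? 5
... | yes D<5 = ∣ S ∣ , Domination.dominating⇒CopsWin {G} {S} dom ,
  subst (λ x → x ^ 2 ≤ 25 * D) (sym (m+n∸m≡n (3 * ∣ S ∣) D)) (square-≤ (≤-trans (<⇒≤ D<5) (m≤n+m 5 20)) ≤-refl)
... | no D≮5 = 2 + K , chase-wins (m≥n⇒m/n>0 (≤-trans (m≤n+m 3 2) 5≤D)) ,
  square-≤ (≤-trans excess≤5 (m≤n+m 5 20)) (≤-trans excess≤5 5≤D)
  where
  5≤D : 5 ≤ D
  5≤D = ≮⇒≥ D≮5
  open Chase dom w shortest (D / 3) (3*[m/3]≤m D)
  excess≤5 : (3 * (2 + K) + D) ∸ 3 * ∣ S ∣ ≤ 5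
  excess≤5 = chase-excess (m≤3*[m/3]+2 D)

theorem4 : Σ ℕ λ C → ∀ (G : Graph) → Connected G → ∀ (D : ℕ) → IsDiameter G D →
    ∀ (S : Subset (Graph.n G)) → Dominating G S →
    ∃ λ k → CopsWin G k × ((3 * k + D) ∸ 3 * ∣ S ∣) ^ 2 ≤ C * D
theorem4 = 25 , λ G _ D diameter S dom →
  let _ , _ , w , shortest = Play.diametral-walk G diameter in few-cops dom w shortest
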